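{- For all formulas $\phi,\psi$ built from proposition letters, $\top,\bot,\wedge,\vee,\Rightarrow$: the consequence pair $\phi\trianglelefteq\psi$ belongs to $\mathbf{PCL}$ if and only if the formula $\phi\to\psi$ is a theorem of $\mathbf{ICK}$.
   Context: $\mathbf{CL}(\Gamma)$ is the smallest set of consequence pairs $\phi\trianglelefteq\psi$ (between formulas $\phi::=p\mid\top\mid\bot\mid\phi\wedge\phi\mid\phi\vee\phi\mid\phi\Rightarrow\phi$) containing $\Gamma$, closed under uniform substitution, containing $p\trianglelefteq\top$, $\bot\trianglelefteq p$, $p\trianglelefteq p$, $p\wedge q\trianglelefteq p$, $p\wedge q\trianglelefteq q$, $p\trianglelefteq p\vee q$, $q\trianglelefteq p\vee q$, $\top\trianglelefteq p\Rightarrow\top$, $p\Rightarrow(q\wedge r)\trianglelefteq(p\Rightarrow q)\wedge(p\Rightarrow r)$, $(p\Rightarrow q)\wedge(p\Rightarrow r)\trianglelefteq p\Rightarrow(q\wedge r)$, closed under transitivity, $\wedge$-introduction (from $r\trianglelefteq p,r\trianglelefteq q$ infer $r\trianglelefteq p\wedge q$), $\vee$-elimination (from $p\trianglelefteq r,q\trianglelefteq r$ infer $p\vee q\trianglelefteq r$), and congruence for $\Rightarrow$ in each argument (from $p\trianglelefteq q,q\trianglelefteq p$ infer $p\Rightarrow r\trianglelefteq q\Rightarrow r$ and $r\Rightarrow p\trianglelefteq r\Rightarrow q$). $\mathbf{PCL}:=\mathbf{CL}(\{p\wedge(q\vee r)\trianglelefteq(p\wedge q)\vee(p\wedge r)\})$.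 $\mathbf{ICK}$ (intuitionistic conditional logic, over the same letters) has formulas $\phi::=p\mid\top\mid\bot\mid\phi\wedge\phi\mid\phi\vee\phi\mid\phi\to\phi\mid\phi\Rightarrow\phi$ and is obtained from an axiomatisation of intuitionistic propositional logic (with $\to$ the intuitionistic implication) by adding the axioms $p\Rightarrow\top$, $(p\Rightarrow(q\wedge r))\to((p\Rightarrow q)\wedge(p\Rightarrow r))$, $((p\Rightarrow q)\wedge(p\Rightarrow r))\to(p\Rightarrow(q\wedge r))$, the congruence rules (from theorems $\phi\leftrightarrow\psi$ infer $(\phi\Rightarrow\chi)\leftrightarrow(\psi\Rightarrow\chi)$ and $(\chi\Rightarrow\phi)\leftrightarrow(\chi\Rightarrow\psi)$), and closing under modus ponens and uniform substitution. -}

module Defs where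

open import Data.Nat using (ℕ)

Letter : Set
Letter = ℕ

infixr 6 _∧_
infixr 5 _∨_
infixr 4 _⇒_

data Fm : Set where
  var  : Letter → Fm
  ⊤    : Fm
  ⊥    : Fm
  _∧_  : Fm → Fm → Fm
  _∨_  : Fm → Fm → Fm
  _⇒_  : Fm → Fm → Fm

subst : (Letter → Fm) → Fm → Fm
subst σ (var x) = σ x
subst σ ⊤ = ⊤
subst σ ⊥ = ⊥
subst σ (a ∧ b) = subst σ a ∧ subst σ b
subst σ (a ∨ b) = subst σ a ∨ subst σ b
subst σ (a ⇒ b) = subst σ a ⇒ subst σ b

p q r : Fm
p = var 0
q = var 1
r = var 2

record Pair : Set where
  constructor _⊴_
  field
    lhs : Fm
    rhs : Fm

infix 2 _⊴_

data CL (Γ : Pair → Set) : Pair → Set where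
  hyp      : ∀ {π} → Γ π → CL Γ π
  usubst   : ∀ σ {φ ψ} → CL Γ (φ ⊴ ψ) → CL Γ (subst σ φ ⊴ subst σ ψ)
  ax-top   : CL Γ (p ⊴ ⊤)
  ax-bot   : CL Γ (⊥ ⊴ p)
  ax-refl  : CL Γ (p ⊴ p)
  ax-∧l    : CL Γ (p ∧ q ⊴ p)
  ax-∧r    : CL Γ (p ∧ q ⊴ q)
  ax-∨l    : CL Γ (p ⊴ p ∨ q)
  ax-∨r    : CL Γ (q ⊴ p ∨ q)
  ax-⇒⊤    : CL Γ (⊤ ⊴ p ⇒ ⊤)
  ax-⇒∧₁   : CL Γ (p ⇒ (q ∧ r) ⊴ (p ⇒ q) ∧ (p ⇒ r))
  ax-⇒∧₂   : CL Γ ((p ⇒ q) ∧ (p ⇒ r) ⊴ p ⇒ (q ∧ r))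
  trans    : ∀ {a b c} → CL Γ (a ⊴ b) → CL Γ (b ⊴ c) → CL Γ (a ⊴ c)
  ∧-intro  : ∀ {a b c} → CL Γ (c ⊴ a) → CL Γ (c ⊴ b) → CL Γ (c ⊴ a ∧ b)
  ∨-elim   : ∀ {a b c} → CL Γ (a ⊴ c) → CL Γ (b ⊴ c) → CL Γ (a ∨ b ⊴ c)
  cong-⇒l  : ∀ {a b c} → CL Γ (a ⊴ b) → CL Γ (b ⊴ a) → CL Γ (a ⇒ c ⊴ b ⇒ c)
  cong-⇒r  : ∀ {a b c} → CL Γ (a ⊴ b) → CL Γ (b ⊴ a) → CL Γ (c ⇒ a ⊴ c ⇒ b)

data Distr : Pair → Set where
  distr : Distr (p ∧ (q ∨ r) ⊴ (p ∧ q) ∨ (p ∧ r))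

PCL : Pair → Set
PCL = CL Distr

-- Formulas of ICK: additionally intuitionistic implication ⊃ (the → of the paper)

infixr 3 _⊃_
infixr 6 _∧ᵢ_
infixr 5 _∨ᵢ_
infixr 4 _⇒ᵢ_

data IFm : Set where
  ivar  : Letter → IFm
  ⊤ᵢ    : IFm
  ⊥ᵢ    : IFm
  _∧ᵢ_  : IFm → IFm → IFm
  _∨ᵢ_  : IFm → IFm → IFm
  _⊃_   : IFm → IFm → IFm
  _⇒ᵢ_  : IFm → IFm → IFm

isubst : (Letter → IFm) → IFm → IFm
isubst σ (ivar x) = σ x
isubst σ ⊤ᵢ = ⊤ᵢ
isubst σ ⊥ᵢ = ⊥ᵢ
isubst σ (a ∧ᵢ b) = isubst σ a ∧ᵢ isubst σ b
isubst σ (a ∨ᵢ b) = isubst σ a ∨ᵢ isubst σ b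
isubst σ (a ⊃ b) = isubst σ a ⊃ isubst σ b
isubst σ (a ⇒ᵢ b) = isubst σ a ⇒ᵢ isubst σ b

_⟷_ : IFm → IFm → IFm
a ⟷ b = (a ⊃ b) ∧ᵢ (b ⊃ a)

P Q R : IFm
P = ivar 0
Q = ivar 1
R = ivar 2

data ICK : IFm → Set where
  ipc-K     : ICK (P ⊃ Q ⊃ P)
  ipc-S     : ICK ((P ⊃ Q ⊃ R) ⊃ (P ⊃ Q) ⊃ P ⊃ R)
  ipc-∧i    : ICK (P ⊃ Q ⊃ P ∧ᵢ Q)
  ipc-∧e₁   : ICK (P ∧ᵢ Q ⊃ P)
  ipc-∧e₂   : ICK (P ∧ᵢ Q ⊃ Q)
  ipc-∨i₁   : ICK (P ⊃ P ∨ᵢ Q)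
  ipc-∨i₂   : ICK (Q ⊃ P ∨ᵢ Q)
  ipc-∨e    : ICK ((P ⊃ R) ⊃ (Q ⊃ R) ⊃ P ∨ᵢ Q ⊃ R)
  ipc-⊤     : ICK ⊤ᵢ
  ipc-⊥     : ICK (⊥ᵢ ⊃ P)
  ck-⇒⊤     : ICK (P ⇒ᵢ ⊤ᵢ)
  ck-⇒∧₁    : ICK ((P ⇒ᵢ (Q ∧ᵢ R)) ⊃ ((P ⇒ᵢ Q) ∧ᵢ (P ⇒ᵢ R)))
  ck-⇒∧₂    : ICK (((P ⇒ᵢ Q) ∧ᵢ (P ⇒ᵢ R)) ⊃ (P ⇒ᵢ (Q ∧ᵢ R)))
  cong-l    : ∀ {a b c} → ICK (a ⟷ b) → ICK ((a ⇒ᵢ c) ⟷ (b ⇒ᵢ c))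
  cong-r    : ∀ {a b c} → ICK (a ⟷ b) → ICK ((c ⇒ᵢ a) ⟷ (c ⇒ᵢ b))
  mp        : ∀ {a b} → ICK (a ⊃ b) → ICK a → ICK b
  usubst    : ∀ σ {a} → ICK a → ICK (isubst σ a)

emb : Fm → IFm
emb (var x) = ivar x
emb ⊤ = ⊤ᵢ
emb ⊥ = ⊥ᵢ
emb (a ∧ b) = emb a ∧ᵢ emb b
emb (a ∨ b) = emb a ∨ᵢ emb b
emb (a ⇒ b) = emb a ⇒ᵢ emb b

-- The translation PCL → ICK is rule-by-rule. For the converse, build a model
-- of ICK from PCL itself: the ideals of the Lindenbaum preorder of PCL form a
-- Heyting algebra (distributivity is exactly what makes the relative
-- pseudo-complement I ⊃ J closed under joins), and the conditional is read on
-- principal ideals as ↓a ⇒ ↓b = ↓(a ⇒ b). Under the valuation p ↦ ↓p every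
-- embedded formula φ denotes ↓φ, so validity of emb φ ⊃ emb ψ gives φ ≤ ψ.
module Submission where

open import Defs
open import Data.Nat using (zero; suc)
open import Data.Product using (Σ; _×_; _,_; proj₁; proj₂)
open import Data.Unit using (tt) renaming (⊤ to Unit)
open import Function.Bundles using (_⇔_; mk⇔)
open import Relation.Binary.PropositionalEquality
  using (_≡_; refl; sym; cong₂; subst₂) renaming (subst to ≡-subst)

infix 1 _≤_
_≤_ : Fm → Fm → Set
a ≤ b = PCL (a ⊴ b)

⟨_,_,_⟩ : Fm → Fm → Fm → Letter → Fm
⟨ a , b , c ⟩ zero          = a
⟨ a , b , c ⟩ (suc zero)    = b
⟨ a , b , c ⟩ (suc (suc _)) = c

instantiate : ∀ a b c {φ ψ} → PCL (φ ⊴ ψ) →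
              subst ⟨ a , b , c ⟩ φ ≤ subst ⟨ a , b , c ⟩ ψ
instantiate a b c = CL.usubst ⟨ a , b , c ⟩

infixr 9 _∙_
_∙_ : ∀ {a b c} → a ≤ b → b ≤ c → a ≤ c
_∙_ = CL.trans

≤-refl : ∀ {a} → a ≤ a
≤-refl {a} = instantiate a a a ax-refl

≤⊤ : ∀ {a} → a ≤ ⊤
≤⊤ {a} = instantiate a a a ax-top

⊥≤ : ∀ {a} → ⊥ ≤ a
⊥≤ {a} = instantiate a a a ax-bot

x∧y≤x : ∀ {a b} → a ∧ b ≤ a
x∧y≤x {a} {b} = instantiate a b b ax-∧l

x∧y≤y : ∀ {a b} → a ∧ b ≤ b
x∧y≤y {a} {b} = instantiate a b b ax-∧r

x≤x∨y : ∀ {a b} → a ≤ a ∨ b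
x≤x∨y {a} {b} = instantiate a b b ax-∨l

y≤x∨y : ∀ {a b} → b ≤ a ∨ b
y≤x∨y {a} {b} = instantiate a b b ax-∨r

∧-monotonic : ∀ {a a′ b b′} → a ≤ a′ → b ≤ b′ → a ∧ b ≤ a′ ∧ b′
∧-monotonic f g = ∧-intro (x∧y≤x ∙ f) (x∧y≤y ∙ g)

∨-monotonic : ∀ {a a′ b b′} → a ≤ a′ → b ≤ b′ → a ∨ b ≤ a′ ∨ b′
∨-monotonic f g = ∨-elim (f ∙ x≤x∨y) (g ∙ y≤x∨y)

∧-comm : ∀ {a b} → a ∧ b ≤ b ∧ a
∧-comm = ∧-intro x∧y≤y x∧y≤x

∧-distribˡ-∨ : ∀ {a b c} → a ∧ (b ∨ c) ≤ (a ∧ b) ∨ (a ∧ c)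
∧-distribˡ-∨ {a} {b} {c} = instantiate a b c (hyp distr)

∧-distribʳ-∨ : ∀ {a b c} → (b ∨ c) ∧ a ≤ (b ∧ a) ∨ (c ∧ a)
∧-distribʳ-∨ = ∧-comm ∙ ∧-distribˡ-∨ ∙ ∨-monotonic ∧-comm ∧-comm

⊤≤⇒⊤ : ∀ {a} → ⊤ ≤ a ⇒ ⊤
⊤≤⇒⊤ {a} = instantiate a a a ax-⇒⊤

⇒-∧-split : ∀ {a b c} → a ⇒ (b ∧ c) ≤ (a ⇒ b) ∧ (a ⇒ c)
⇒-∧-split {a} {b} {c} = instantiate a b c ax-⇒∧₁

⇒-∧-merge : ∀ {a b c} → (a ⇒ b) ∧ (a ⇒ c) ≤ a ⇒ (b ∧ c)
⇒-∧-merge {a} {b} {c} = instantiate a b c ax-⇒∧₂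

-- b ≤ c makes b and b ∧ c equivalent, and a ⇒ (b ∧ c) ≤ a ⇒ c.
⇒-monotonicʳ : ∀ {a b c} → b ≤ c → a ⇒ b ≤ a ⇒ c
⇒-monotonicʳ b≤c = cong-⇒r (∧-intro ≤-refl b≤c) x∧y≤x ∙ ⇒-∧-split ∙ x∧y≤y

record Ideal : Set₁ where
  field
    mem         : Fm → Set
    down-closed : ∀ {x y} → y ≤ x → mem x → mem y
    ⊥∈          : mem ⊥
    ∨-closed    : ∀ {x y} → mem x → mem y → mem (x ∨ y)
open Ideal

infix 4 _∈_ _⊆_ _≃_
_∈_ : Fm → Ideal → Set
x ∈ I = mem I x

_⊆_ : Ideal → Ideal → Set
I ⊆ J = ∀ {x} → x ∈ I → x ∈ J

_≃_ : Ideal → Ideal → Set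
I ≃ J = (I ⊆ J) × (J ⊆ I)

≃-sym : ∀ {I J} → I ≃ J → J ≃ I
≃-sym (I⊆J , J⊆I) = J⊆I , I⊆J

≃-trans : ∀ {I J K} → I ≃ J → J ≃ K → I ≃ K
≃-trans (I⊆J , J⊆I) (J⊆K , K⊆J) = (λ m → J⊆K (I⊆J m)) , (λ m → J⊆I (K⊆J m))

Full : Ideal → Set
Full I = ∀ {x} → x ∈ I

↓ : Fm → Ideal
↓ a = record
  { mem = _≤ a ; down-closed = _∙_ ; ⊥∈ = ⊥≤ ; ∨-closed = ∨-elim }

⊤ᴵ : Ideal
⊤ᴵ = record
  { mem = λ _ → Unit ; down-closed = λ _ _ → tt ; ⊥∈ = tt ; ∨-closed = λ _ _ → tt }

infixr 8 _∧ᴵ_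
infixr 7 _∨ᴵ_
infixr 6 _⇒ᴵ_
infixr 5 _⊃ᴵ_

_∧ᴵ_ : Ideal → Ideal → Ideal
I ∧ᴵ J = record
  { mem         = λ x → x ∈ I × x ∈ J
  ; down-closed = λ y≤x (xI , xJ) → down-closed I y≤x xI , down-closed J y≤x xJ
  ; ⊥∈          = ⊥∈ I , ⊥∈ J
  ; ∨-closed    = λ (xI , xJ) (yI , yJ) → ∨-closed I xI yI , ∨-closed J xJ yJ
  }

_∨ᴵ_ : Ideal → Ideal → Ideal
I ∨ᴵ J = record
  { mem         = λ x → Σ Fm λ a → Σ Fm λ b → a ∈ I × b ∈ J × (x ≤ a ∨ b)
  ; down-closed = λ y≤x (a , b , aI , bJ , x≤) → a , b , aI , bJ , y≤x ∙ x≤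
  ; ⊥∈          = ⊥ , ⊥ , ⊥∈ I , ⊥∈ J , ⊥≤
  ; ∨-closed    = λ (a , b , aI , bJ , x≤) (a′ , b′ , a′I , b′J , y≤) →
      a ∨ a′ , b ∨ b′ , ∨-closed I aI a′I , ∨-closed J bJ b′J ,
      ∨-elim (x≤ ∙ ∨-monotonic x≤x∨y x≤x∨y) (y≤ ∙ ∨-monotonic y≤x∨y y≤x∨y)
  }

_⊃ᴵ_ : Ideal → Ideal → Ideal
I ⊃ᴵ J = record
  { mem         = λ x → ∀ y → y ∈ I → x ∧ y ∈ J
  ; down-closed = λ y≤x f z zI → down-closed J (∧-monotonic y≤x ≤-refl) (f z zI)
  ; ⊥∈          = λ _ _ → down-closed J x∧y≤x (⊥∈ J)
  ; ∨-closed    = λ f g z zI →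
      down-closed J ∧-distribʳ-∨ (∨-closed J (f z zI) (g z zI))
  }

-- On a non-principal I the condition is vacuous and I ⇒ᴵ J is everything;
-- quantifying over all presentations I ≃ ↓ a makes I ⇒ᴵ J depend on I only
-- up to ≃, which is what the congruence rules need.
_⇒ᴵ_ : Ideal → Ideal → Ideal
I ⇒ᴵ J = record
  { mem         = λ x → ∀ a → I ≃ ↓ a → Σ Fm λ b → b ∈ J × (x ≤ a ⇒ b)
  ; down-closed = λ y≤x f a I≃↓a →
      let (b , bJ , x≤) = f a I≃↓a in b , bJ , y≤x ∙ x≤
  ; ⊥∈          = λ _ _ → ⊥ , ⊥∈ J , ⊥≤
  ; ∨-closed    = λ f g a I≃↓a →
      let (b , bJ , x≤) = f a I≃↓a ; (b′ , b′J , y≤) = g a I≃↓a in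
      b ∨ b′ , ∨-closed J bJ b′J ,
      ∨-elim (x≤ ∙ ⇒-monotonicʳ x≤x∨y) (y≤ ∙ ⇒-monotonicʳ y≤x∨y)
  }

⊃ᴵ-intro : ∀ I J {x} → (∀ {z} → z ≤ x → z ∈ I → z ∈ J) → x ∈ I ⊃ᴵ J
⊃ᴵ-intro I J f y yI = f x∧y≤x (down-closed I x∧y≤y yI)

⊃ᴵ-elim : ∀ I J {x} → x ∈ I ⊃ᴵ J → x ∈ I → x ∈ J
⊃ᴵ-elim I J {x} f xI = down-closed J (∧-intro ≤-refl ≤-refl) (f x xI)

⊃ᴵ-full⇒⊆ : ∀ {I J} → Full (I ⊃ᴵ J) → I ⊆ J
⊃ᴵ-full⇒⊆ {I} {J} f = ⊃ᴵ-elim I J f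

⊆⇒⊃ᴵ-full : ∀ {I J} → I ⊆ J → Full (I ⊃ᴵ J)
⊆⇒⊃ᴵ-full {I} {J} I⊆J = ⊃ᴵ-intro I J λ _ → I⊆J

K-full : ∀ I J → Full (I ⊃ᴵ J ⊃ᴵ I)
K-full I J = ⊃ᴵ-intro I (J ⊃ᴵ I) λ _ zI →
  ⊃ᴵ-intro J I λ w≤z _ → down-closed I w≤z zI

S-full : ∀ I J K → Full ((I ⊃ᴵ J ⊃ᴵ K) ⊃ᴵ (I ⊃ᴵ J) ⊃ᴵ I ⊃ᴵ K)
S-full I J K = ⊃ᴵ-intro (I ⊃ᴵ J ⊃ᴵ K) ((I ⊃ᴵ J) ⊃ᴵ I ⊃ᴵ K) λ _ f →
  ⊃ᴵ-intro (I ⊃ᴵ J) (I ⊃ᴵ K) λ w≤z g →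
  ⊃ᴵ-intro I K λ u≤w uI →
    ⊃ᴵ-elim J K (⊃ᴵ-elim I (J ⊃ᴵ K) (down-closed (I ⊃ᴵ J ⊃ᴵ K) (u≤w ∙ w≤z) f) uI)
                (⊃ᴵ-elim I J (down-closed (I ⊃ᴵ J) u≤w g) uI)

∧-intro-full : ∀ I J → Full (I ⊃ᴵ J ⊃ᴵ I ∧ᴵ J)
∧-intro-full I J = ⊃ᴵ-intro I (J ⊃ᴵ I ∧ᴵ J) λ _ zI →
  ⊃ᴵ-intro J (I ∧ᴵ J) λ w≤z wJ → down-closed I w≤z zI , wJ

∧-elimˡ-full : ∀ I J → Full (I ∧ᴵ J ⊃ᴵ I)
∧-elimˡ-full I J = ⊆⇒⊃ᴵ-full {I ∧ᴵ J} {I} proj₁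

∧-elimʳ-full : ∀ I J → Full (I ∧ᴵ J ⊃ᴵ J)
∧-elimʳ-full I J = ⊆⇒⊃ᴵ-full {I ∧ᴵ J} {J} proj₂

∨-introˡ-full : ∀ I J → Full (I ⊃ᴵ I ∨ᴵ J)
∨-introˡ-full I J = ⊆⇒⊃ᴵ-full {I} {I ∨ᴵ J} λ {x} xI → x , ⊥ , xI , ⊥∈ J , x≤x∨y

∨-introʳ-full : ∀ I J → Full (J ⊃ᴵ I ∨ᴵ J)
∨-introʳ-full I J = ⊆⇒⊃ᴵ-full {J} {I ∨ᴵ J} λ {x} xJ → ⊥ , x , ⊥∈ I , xJ , y≤x∨y

∨-elim-full : ∀ I J K → Full ((I ⊃ᴵ K) ⊃ᴵ (J ⊃ᴵ K) ⊃ᴵ I ∨ᴵ J ⊃ᴵ K)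
∨-elim-full I J K = ⊃ᴵ-intro (I ⊃ᴵ K) ((J ⊃ᴵ K) ⊃ᴵ I ∨ᴵ J ⊃ᴵ K) λ _ f →
  ⊃ᴵ-intro (J ⊃ᴵ K) (I ∨ᴵ J ⊃ᴵ K) λ w≤z g →
  ⊃ᴵ-intro (I ∨ᴵ J) K λ u≤w (a , b , aI , bJ , u≤) →
    down-closed K (∧-intro ≤-refl u≤ ∙ ∧-distribˡ-∨ ∙ ∨-monotonic ∧-comm ∧-comm)
      (∨-closed K
        (⊃ᴵ-elim I K (down-closed (I ⊃ᴵ K) (x∧y≤y ∙ u≤w ∙ w≤z) f)
                     (down-closed I x∧y≤x aI))
        (⊃ᴵ-elim J K (down-closed (J ⊃ᴵ K) (x∧y≤y ∙ u≤w) g)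
                     (down-closed J x∧y≤x bJ)))

⊥-elim-full : ∀ I → Full (↓ ⊥ ⊃ᴵ I)
⊥-elim-full I = ⊆⇒⊃ᴵ-full {↓ ⊥} {I} λ x≤⊥ → down-closed I x≤⊥ (⊥∈ I)

⇒ᴵ⊤-full : ∀ I → Full (I ⇒ᴵ ⊤ᴵ)
⇒ᴵ⊤-full I _ _ = ⊤ , tt , ≤⊤ ∙ ⊤≤⇒⊤

⇒ᴵ-∧-split-full : ∀ I J K → Full ((I ⇒ᴵ J ∧ᴵ K) ⊃ᴵ (I ⇒ᴵ J) ∧ᴵ (I ⇒ᴵ K))
⇒ᴵ-∧-split-full I J K = ⊆⇒⊃ᴵ-full {I ⇒ᴵ J ∧ᴵ K} {(I ⇒ᴵ J) ∧ᴵ (I ⇒ᴵ K)} λ f →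
    (λ a I≃↓a → let (b , (bJ , _) , x≤) = f a I≃↓a in b , bJ , x≤)
  , (λ a I≃↓a → let (b , (_ , bK) , x≤) = f a I≃↓a in b , bK , x≤)

⇒ᴵ-∧-merge-full : ∀ I J K → Full ((I ⇒ᴵ J) ∧ᴵ (I ⇒ᴵ K) ⊃ᴵ (I ⇒ᴵ J ∧ᴵ K))
⇒ᴵ-∧-merge-full I J K = ⊆⇒⊃ᴵ-full {(I ⇒ᴵ J) ∧ᴵ (I ⇒ᴵ K)} {I ⇒ᴵ J ∧ᴵ K}
  λ (f , g) a I≃↓a →
    let (b , bJ , x≤) = f a I≃↓a ; (c , cK , x≤′) = g a I≃↓a in
    b ∧ c , (down-closed J x∧y≤x bJ , down-closed K x∧y≤y cK) ,
    ∧-intro x≤ x≤′ ∙ ⇒-∧-merge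

⇒ᴵ-respˡ-⊆ : ∀ {I J K} → I ≃ J → (I ⇒ᴵ K) ⊆ (J ⇒ᴵ K)
⇒ᴵ-respˡ-⊆ {I} {J} I≃J f a J≃↓a = f a (≃-trans {I} {J} {↓ a} I≃J J≃↓a)

⇒ᴵ-respʳ-⊆ : ∀ {I J K} → J ⊆ K → (I ⇒ᴵ J) ⊆ (I ⇒ᴵ K)
⇒ᴵ-respʳ-⊆ J⊆K f a I≃↓a = let (b , bJ , x≤) = f a I≃↓a in b , J⊆K bJ , x≤

Valuation : Set₁
Valuation = Letter → Ideal

⟦_⟧ : IFm → Valuation → Ideal
⟦ ivar x ⟧ v = v x
⟦ ⊤ᵢ ⟧     v = ⊤ᴵ
⟦ ⊥ᵢ ⟧     v = ↓ ⊥
⟦ a ∧ᵢ b ⟧ v = ⟦ a ⟧ v ∧ᴵ ⟦ b ⟧ v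
⟦ a ∨ᵢ b ⟧ v = ⟦ a ⟧ v ∨ᴵ ⟦ b ⟧ v
⟦ a ⊃ b ⟧  v = ⟦ a ⟧ v ⊃ᴵ ⟦ b ⟧ v
⟦ a ⇒ᵢ b ⟧ v = ⟦ a ⟧ v ⇒ᴵ ⟦ b ⟧ v

⊨_ : IFm → Set₁
⊨ a = ∀ v → Full (⟦ a ⟧ v)

⟦isubst⟧ : ∀ σ a v → ⟦ isubst σ a ⟧ v ≡ ⟦ a ⟧ (λ x → ⟦ σ x ⟧ v)
⟦isubst⟧ σ (ivar x) v = refl
⟦isubst⟧ σ ⊤ᵢ       v = refl
⟦isubst⟧ σ ⊥ᵢ       v = refl
⟦isubst⟧ σ (a ∧ᵢ b) v = cong₂ _∧ᴵ_ (⟦isubst⟧ σ a v) (⟦isubst⟧ σ b v)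
⟦isubst⟧ σ (a ∨ᵢ b) v = cong₂ _∨ᴵ_ (⟦isubst⟧ σ a v) (⟦isubst⟧ σ b v)
⟦isubst⟧ σ (a ⊃ b)  v = cong₂ _⊃ᴵ_ (⟦isubst⟧ σ a v) (⟦isubst⟧ σ b v)
⟦isubst⟧ σ (a ⇒ᵢ b) v = cong₂ _⇒ᴵ_ (⟦isubst⟧ σ a v) (⟦isubst⟧ σ b v)

⊨⟷⇒≃ : ∀ {a b} → ⊨ (a ⟷ b) → ∀ v → ⟦ a ⟧ v ≃ ⟦ b ⟧ v
⊨⟷⇒≃ {a} {b} a⟷b v =
  ⊃ᴵ-full⇒⊆ {⟦ a ⟧ v} {⟦ b ⟧ v} (proj₁ (a⟷b v)) ,
  ⊃ᴵ-full⇒⊆ {⟦ b ⟧ v} {⟦ a ⟧ v} (proj₂ (a⟷b v))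

ICK-sound : ∀ {a} → ICK a → ⊨ a
ICK-sound ipc-K   v = K-full (v 0) (v 1)
ICK-sound ipc-S   v = S-full (v 0) (v 1) (v 2)
ICK-sound ipc-∧i  v = ∧-intro-full (v 0) (v 1)
ICK-sound ipc-∧e₁ v = ∧-elimˡ-full (v 0) (v 1)
ICK-sound ipc-∧e₂ v = ∧-elimʳ-full (v 0) (v 1)
ICK-sound ipc-∨i₁ v = ∨-introˡ-full (v 0) (v 1)
ICK-sound ipc-∨i₂ v = ∨-introʳ-full (v 0) (v 1)
ICK-sound ipc-∨e  v = ∨-elim-full (v 0) (v 1) (v 2)
ICK-sound ipc-⊤   v = tt
ICK-sound ipc-⊥   v = ⊥-elim-full (v 0)
ICK-sound ck-⇒⊤   v = ⇒ᴵ⊤-full (v 0)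
ICK-sound ck-⇒∧₁  v = ⇒ᴵ-∧-split-full (v 0) (v 1) (v 2)
ICK-sound ck-⇒∧₂  v = ⇒ᴵ-∧-merge-full (v 0) (v 1) (v 2)
ICK-sound (cong-l {a} {b} {c} a⟷b) v =
  ⊆⇒⊃ᴵ-full {A ⇒ᴵ C} {B ⇒ᴵ C} (⇒ᴵ-respˡ-⊆ {A} {B} {C} A≃B) ,
  ⊆⇒⊃ᴵ-full {B ⇒ᴵ C} {A ⇒ᴵ C} (⇒ᴵ-respˡ-⊆ {B} {A} {C} (≃-sym {A} {B} A≃B))
  where A = ⟦ a ⟧ v ; B = ⟦ b ⟧ v ; C = ⟦ c ⟧ v
        A≃B = ⊨⟷⇒≃ {a} {b} (ICK-sound a⟷b) v
ICK-sound (cong-r {a} {b} {c} a⟷b) v =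
  ⊆⇒⊃ᴵ-full {C ⇒ᴵ A} {C ⇒ᴵ B} (⇒ᴵ-respʳ-⊆ {C} {A} {B} (proj₁ A≃B)) ,
  ⊆⇒⊃ᴵ-full {C ⇒ᴵ B} {C ⇒ᴵ A} (⇒ᴵ-respʳ-⊆ {C} {B} {A} (proj₂ A≃B))
  where A = ⟦ a ⟧ v ; B = ⟦ b ⟧ v ; C = ⟦ c ⟧ v
        A≃B = ⊨⟷⇒≃ {a} {b} (ICK-sound a⟷b) v
ICK-sound (mp {a} {b} a⊃b ⊢a) v =
  ⊃ᴵ-full⇒⊆ {⟦ a ⟧ v} {⟦ b ⟧ v} (ICK-sound a⊃b v) (ICK-sound ⊢a v)
ICK-sound (ICK.usubst σ {a} ⊢a) v {x} =
  ≡-subst (x ∈_) (sym (⟦isubst⟧ σ a v)) (ICK-sound ⊢a (λ y → ⟦ σ y ⟧ v))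

canonical : Valuation
canonical x = ↓ (var x)

⟦emb⟧-canonical : ∀ φ → ⟦ emb φ ⟧ canonical ≃ ↓ φ
⟦emb⟧-canonical (var x) = (λ m → m) , (λ m → m)
⟦emb⟧-canonical ⊤       = (λ _ → ≤⊤) , (λ _ → tt)
⟦emb⟧-canonical ⊥       = (λ m → m) , (λ m → m)
⟦emb⟧-canonical (φ ∧ ψ) with ⟦emb⟧-canonical φ | ⟦emb⟧-canonical ψ
... | (φ⊆ , ⊆φ) | (ψ⊆ , ⊆ψ) =
  (λ (xφ , xψ) → ∧-intro (φ⊆ xφ) (ψ⊆ xψ)) ,
  (λ x≤ → ⊆φ (x≤ ∙ x∧y≤x) , ⊆ψ (x≤ ∙ x∧y≤y))
⟦emb⟧-canonical (φ ∨ ψ) with ⟦emb⟧-canonical φ | ⟦emb⟧-canonical ψ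
... | (φ⊆ , ⊆φ) | (ψ⊆ , ⊆ψ) =
  (λ (a , b , aφ , bψ , x≤) → x≤ ∙ ∨-monotonic (φ⊆ aφ) (ψ⊆ bψ)) ,
  (λ x≤ → φ , ψ , ⊆φ ≤-refl , ⊆ψ ≤-refl , x≤)
⟦emb⟧-canonical (φ ⇒ ψ) with ⟦emb⟧-canonical φ | ⟦emb⟧-canonical ψ
... | (φ⊆ , ⊆φ) | (ψ⊆ , ⊆ψ) =
  (λ f → let (b , bψ , x≤) = f φ (φ⊆ , ⊆φ) in x≤ ∙ ⇒-monotonicʳ (ψ⊆ bψ)) ,
  (λ x≤ a (⊆a , a⊆) →
     ψ , ⊆ψ ≤-refl , x≤ ∙ cong-⇒l (⊆a (⊆φ ≤-refl)) (φ⊆ (a⊆ ≤-refl)))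

ICK⇒PCL : ∀ {φ ψ} → ICK (emb φ ⊃ emb ψ) → φ ≤ ψ
ICK⇒PCL {φ} {ψ} ⊢φ⊃ψ =
  proj₁ (⟦emb⟧-canonical ψ)
    (⊃ᴵ-full⇒⊆ {⟦ emb φ ⟧ canonical} {⟦ emb ψ ⟧ canonical}
      (ICK-sound ⊢φ⊃ψ canonical) (proj₂ (⟦emb⟧-canonical φ) ≤-refl))

⟨_,_,_⟩ᵢ : IFm → IFm → IFm → Letter → IFm
⟨ a , b , c ⟩ᵢ zero          = a
⟨ a , b , c ⟩ᵢ (suc zero)    = b
⟨ a , b , c ⟩ᵢ (suc (suc _)) = c

K : ∀ {a b} → ICK (a ⊃ b ⊃ a)
K {a} {b} = ICK.usubst ⟨ a , b , a ⟩ᵢ ipc-K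

S : ∀ {a b c} → ICK ((a ⊃ b ⊃ c) ⊃ (a ⊃ b) ⊃ a ⊃ c)
S {a} {b} {c} = ICK.usubst ⟨ a , b , c ⟩ᵢ ipc-S

∧ᵢ-intro : ∀ {a b} → ICK (a ⊃ b ⊃ a ∧ᵢ b)
∧ᵢ-intro {a} {b} = ICK.usubst ⟨ a , b , a ⟩ᵢ ipc-∧i

∧ᵢ-elimˡ : ∀ {a b} → ICK (a ∧ᵢ b ⊃ a)
∧ᵢ-elimˡ {a} {b} = ICK.usubst ⟨ a , b , a ⟩ᵢ ipc-∧e₁

∧ᵢ-elimʳ : ∀ {a b} → ICK (a ∧ᵢ b ⊃ b)
∧ᵢ-elimʳ {a} {b} = ICK.usubst ⟨ a , b , a ⟩ᵢ ipc-∧e₂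

∨ᵢ-introˡ : ∀ {a b} → ICK (a ⊃ a ∨ᵢ b)
∨ᵢ-introˡ {a} {b} = ICK.usubst ⟨ a , b , a ⟩ᵢ ipc-∨i₁

∨ᵢ-introʳ : ∀ {a b} → ICK (b ⊃ a ∨ᵢ b)
∨ᵢ-introʳ {a} {b} = ICK.usubst ⟨ a , b , a ⟩ᵢ ipc-∨i₂

∨ᵢ-elim : ∀ {a b c} → ICK ((a ⊃ c) ⊃ (b ⊃ c) ⊃ a ∨ᵢ b ⊃ c)
∨ᵢ-elim {a} {b} {c} = ICK.usubst ⟨ a , b , c ⟩ᵢ ipc-∨e

⊃-const : ∀ {a b} → ICK b → ICK (a ⊃ b)
⊃-const = mp K

⊃-app : ∀ {a b c} → ICK (c ⊃ a ⊃ b) → ICK (c ⊃ a) → ICK (c ⊃ b)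
⊃-app f g = mp (mp S f) g

⊃-refl : ∀ {a} → ICK (a ⊃ a)
⊃-refl {a} = ⊃-app (K {a} {a ⊃ a}) K

⊃-trans : ∀ {a b c} → ICK (a ⊃ b) → ICK (b ⊃ c) → ICK (a ⊃ c)
⊃-trans f g = ⊃-app (⊃-const g) f

⊃-∧-intro : ∀ {a b c} → ICK (c ⊃ a) → ICK (c ⊃ b) → ICK (c ⊃ a ∧ᵢ b)
⊃-∧-intro f g = ⊃-app (⊃-app (⊃-const ∧ᵢ-intro) f) g

⊃-∨-elim : ∀ {a b c} → ICK (a ⊃ c) → ICK (b ⊃ c) → ICK (a ∨ᵢ b ⊃ c)
⊃-∨-elim f g = mp (mp ∨ᵢ-elim f) g

⟷-intro : ∀ {a b} → ICK (a ⊃ b) → ICK (b ⊃ a) → ICK (a ⟷ b)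
⟷-intro f g = mp (mp ∧ᵢ-intro f) g

⟷-elimˡ : ∀ {a b} → ICK (a ⟷ b) → ICK (a ⊃ b)
⟷-elimˡ = mp ∧ᵢ-elimˡ

∧ᵢ-distribˡ-∨ᵢ : ∀ {a b c} → ICK (a ∧ᵢ (b ∨ᵢ c) ⊃ (a ∧ᵢ b) ∨ᵢ (a ∧ᵢ c))
∧ᵢ-distribˡ-∨ᵢ = uncurry (⊃-app (⊃-app (⊃-const ∨ᵢ-elim) (curried ∨ᵢ-introˡ))
                                                      (curried ∨ᵢ-introʳ))
  where
  postcompose : ∀ {b y z} → ICK (z ⊃ y) → ICK ((b ⊃ z) ⊃ (b ⊃ y))
  postcompose g = mp S (⊃-const g)
  curried : ∀ {a b d} → ICK (a ∧ᵢ b ⊃ d) → ICK (a ⊃ b ⊃ d)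
  curried f = ⊃-trans ∧ᵢ-intro (postcompose f)
  uncurry : ∀ {a b c} → ICK (a ⊃ b ⊃ c) → ICK (a ∧ᵢ b ⊃ c)
  uncurry f = ⊃-app (⊃-trans ∧ᵢ-elimˡ f) ∧ᵢ-elimʳ

emb-subst : ∀ σ φ → emb (subst σ φ) ≡ isubst (λ x → emb (σ x)) (emb φ)
emb-subst σ (var x) = refl
emb-subst σ ⊤       = refl
emb-subst σ ⊥       = refl
emb-subst σ (a ∧ b) = cong₂ _∧ᵢ_ (emb-subst σ a) (emb-subst σ b)
emb-subst σ (a ∨ b) = cong₂ _∨ᵢ_ (emb-subst σ a) (emb-subst σ b)
emb-subst σ (a ⇒ b) = cong₂ _⇒ᵢ_ (emb-subst σ a) (emb-subst σ b)

PCL⇒ICK : ∀ {φ ψ} → PCL (φ ⊴ ψ) → ICK (emb φ ⊃ emb ψ)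
PCL⇒ICK (hyp distr) = ∧ᵢ-distribˡ-∨ᵢ
PCL⇒ICK (CL.usubst σ {φ} {ψ} d) =
  subst₂ (λ A B → ICK (A ⊃ B)) (sym (emb-subst σ φ)) (sym (emb-subst σ ψ))
    (ICK.usubst (λ x → emb (σ x)) (PCL⇒ICK d))
PCL⇒ICK ax-top          = ⊃-const ipc-⊤
PCL⇒ICK ax-bot          = ipc-⊥
PCL⇒ICK ax-refl         = ⊃-refl
PCL⇒ICK ax-∧l           = ipc-∧e₁
PCL⇒ICK ax-∧r           = ipc-∧e₂
PCL⇒ICK ax-∨l           = ipc-∨i₁
PCL⇒ICK ax-∨r           = ipc-∨i₂
PCL⇒ICK ax-⇒⊤           = ⊃-const ck-⇒⊤
PCL⇒ICK ax-⇒∧₁          = ck-⇒∧₁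
PCL⇒ICK ax-⇒∧₂          = ck-⇒∧₂
PCL⇒ICK (CL.trans f g)  = ⊃-trans (PCL⇒ICK f) (PCL⇒ICK g)
PCL⇒ICK (∧-intro f g)   = ⊃-∧-intro (PCL⇒ICK f) (PCL⇒ICK g)
PCL⇒ICK (∨-elim f g)    = ⊃-∨-elim (PCL⇒ICK f) (PCL⇒ICK g)
PCL⇒ICK (cong-⇒l f g)   = ⟷-elimˡ (cong-l (⟷-intro (PCL⇒ICK f) (PCL⇒ICK g)))
PCL⇒ICK (cong-⇒r f g)   = ⟷-elimˡ (cong-r (⟷-intro (PCL⇒ICK f) (PCL⇒ICK g)))

theorem5p11 : (φ ψ : Fm) → PCL (φ ⊴ ψ) ⇔ ICK (emb φ ⊃ emb ψ)
theorem5p11 φ ψ = mk⇔ PCL⇒ICK ICK⇒PCL
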